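{- Let $m$ be a positive integer, let $B\subseteq m\mathbb Z$ be a finite set, and let $F\subseteq\mathbb Z$ be a finite nonempty set whose elements are all congruent to one another modulo $m$ and not divisible by $m$. If there exists $W\subseteq\mathbb Z$ such that $m\mathbb Z_-\setminus B=F+W$, then $m\mathbb N\cup B\cup F$ arises as a minimal additive complement in $\mathbb Z$.
   Context: $\mathbb N=\{0,1,2,\dots\}$ and $m\mathbb Z_-=\{mk:k\in\mathbb Z,\ k<0\}$. For subsets $C,W$ of $\mathbb Z$, $C+W=\{c+w:c\in C,w\in W\}$. $C$ is a minimal additive complement (MAC) to $W$ if $C+W=\mathbb Z$ and no proper subset $C'\subsetneq C$ satisfies $C'+W=\mathbb Z$. $C$ arises as a MAC if there exists some $W\subseteq\mathbb Z$ to which $C$ is a MAC. -}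

module Defs where

open import Level using (0ℓ)
open import Data.Nat as ℕ using (ℕ; suc)
open import Data.Integer using (ℤ; +_; -_; _+_; _-_; _*_)
open import Data.Integer.Divisibility using (_∣_)
open import Data.Product using (Σ; _×_; ∃)
open import Data.Sum using (_⊎_)
open import Data.List using (List)
open import Data.List.Membership.Propositional using (_∈_)
open import Relation.Nullary using (¬_)
open import Relation.Binary.PropositionalEquality using (_≡_)

SubZ : Set₁
SubZ = ℤ → Set

⟦_⟧ : List ℤ → SubZ
⟦ L ⟧ z = z ∈ L

_⊆_ : SubZ → SubZ → Set
C ⊆ D = ∀ z → C z → D z

_∪_ : SubZ → SubZ → SubZ
(C ∪ D) z = C z ⊎ D z

_∖_ : SubZ → SubZ → SubZ
(C ∖ D) z = C z × ¬ D z

_⊕_ : SubZ → SubZ → SubZ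
(C ⊕ W) z = Σ ℤ λ c → Σ ℤ λ w → C c × W w × z ≡ c + w

_≐_ : SubZ → SubZ → Set
C ≐ D = C ⊆ D × D ⊆ C

Covers : SubZ → SubZ → Set
Covers C W = ∀ z → (C ⊕ W) z

multℕ : ℕ → SubZ
multℕ m z = Σ ℕ λ k → z ≡ + m * + k

multℤ₋ : ℕ → SubZ
multℤ₋ m z = Σ ℕ λ k → z ≡ - (+ m * + suc k)

IsMAC : SubZ → SubZ → Set₁
IsMAC C W = Covers C W ×
  (∀ (C' : SubZ) → C' ⊆ C → (Σ ℤ λ x → C x × ¬ C' x) → ¬ Covers C' W)

ArisesAsMAC : SubZ → Set₁
ArisesAsMAC C = Σ SubZ λ W → IsMAC C W

module Submission where

-- Write A = mℤ₋ ∖ B = F + W, C = mℕ ∪ B ∪ F, R = Σ_{f ∈ F} |f| and β = Σ_{b ∈ B} |b|.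
-- Take a multiple T of m that is large compared with R and β, put N g = T (g + R + 1), and
-- call w a collision if w = -N g - g' for some g ≠ g' in F.  The complement is
--   W₂ = {0} ∪ W₁ ∪ {w : w ≢ 0, w ≢ -f₀ (mod m)},
--   W₁ = (W ∪ {w ≡ -f₀ (mod m) : w < -(R + β)}) minus the collisions.
-- Residues mod m and sizes give C + W₂ = ℤ, and F + W₁ is still A: if y = f + w with w a
-- collision, then some y - f' is not a collision, since otherwise (T being large) translation
-- by g' - f would map the finite set F into itself.  For minimality, x ∈ mℕ ∪ B is reached only
-- as x + 0, and -N x for x ∈ F only as x + w, because the other candidates for w are collisions.

open import Defs
open import Data.Empty using (⊥-elim)
open import Data.Integer as ℤ
  using (ℤ; +_; -[1+_]; -_; _+_; _-_; _*_; ∣_∣; 0ℤ; 1ℤ; _≤_; _<_; +≤+; +<+; -≤+)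
import Data.Integer.Properties as ℤP
open import Data.Integer.Divisibility using (_∣_)
open import Data.Integer.Divisibility.Signed as Signed
  using (∣ᵤ⇒∣; ∣⇒∣ᵤ) renaming (_∣_ to _∣ˢ_; _∣?_ to _∣ˢ?_)
open import Data.Integer.Tactic.RingSolver using (solve-∀; solve)
open import Data.List using (List; []; _∷_; map)
open import Data.List.Membership.Propositional using (_∈_; find; lose)
open import Data.List.Membership.DecPropositional ℤP._≟_ using (_∈?_)
open import Data.List.Relation.Unary.Any using (here; there; any?)
open import Data.Nat as ℕ using (ℕ; zero; suc)
open import Data.Nat.ListAction using (sum)
import Data.Nat.Divisibility as ℕD
import Data.Nat.Properties as ℕP
open import Data.Product using (Σ; ∃; ∃-syntax; _×_; _,_; proj₁; proj₂)
open import Data.Sum using (_⊎_; inj₁; inj₂)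
open import Function using (_∘_)
open import Relation.Binary.PropositionalEquality
  using (_≡_; _≢_; refl; sym; trans; cong; cong₂; subst; module ≡-Reasoning)
open import Relation.Nullary using (¬_; Dec; yes; no; ¬?)
open import Relation.Nullary.Decidable using (decidable-stable; map′; _×-dec_)
open import Relation.Unary using (Decidable)

i≡j+[i-j] : ∀ i j → i ≡ j + (i - j)
i≡j+[i-j] = solve-∀

i≡j+k⇒k≡i-j : ∀ {i j k} → i ≡ j + k → k ≡ i - j
i≡j+k⇒k≡i-j {i} {j} {k} refl = solve (j ∷ k ∷ [])

i≡j+k⇒k≡0⇒j≡i : ∀ {i j k} → i ≡ j + k → k ≡ 0ℤ → j ≡ i
i≡j+k⇒k≡0⇒j≡i {j = j} refl refl = sym (ℤP.+-identityʳ j)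

i+j<k⇒i-k<-j : ∀ i j k → i + j < k → i - k < - j
i+j<k⇒i-k<-j i j k i+j<k = begin-strict
  i - k             ≡⟨ solve (i ∷ j ∷ k ∷ []) ⟩
  (i + j) - k - j   <⟨ ℤP.+-monoˡ-< (- j) (ℤP.+-monoˡ-< (- k) i+j<k) ⟩
  k - k - j         ≡⟨ solve (j ∷ k ∷ []) ⟩
  - j               ∎
  where open ℤP.≤-Reasoning

∣i∣≤n⇒i≤n : ∀ {i n} → ∣ i ∣ ℕ.≤ n → i ≤ + n
∣i∣≤n⇒i≤n {+ _}       ∣i∣≤n = +≤+ ∣i∣≤n
∣i∣≤n⇒i≤n { -[1+ _ ]} _     = -≤+

∣i∣≤n⇒-n≤i : ∀ {i n} → ∣ i ∣ ℕ.≤ n → - + n ≤ i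
∣i∣≤n⇒-n≤i {+ _}       _     = ℤP.neg-≤-pos
∣i∣≤n⇒-n≤i { -[1+ _ ]} ∣i∣≤n = ℤP.neg-mono-≤ (+≤+ ∣i∣≤n)

∣n*i∣<n⇒i≡0 : ∀ n i → ∣ + n * i ∣ ℕ.< n → i ≡ 0ℤ
∣n*i∣<n⇒i≡0 n i ∣n*i∣<n = ℤP.∣i∣≡0⇒i≡0 (ℕP.n<1⇒n≡0 (ℕP.*-cancelˡ-< n ∣ i ∣ 1 n*∣i∣<n*1))
  where
  open ℕP.≤-Reasoning
  n*∣i∣<n*1 : n ℕ.* ∣ i ∣ ℕ.< n ℕ.* 1
  n*∣i∣<n*1 = begin-strict
    n ℕ.* ∣ i ∣  ≡⟨ ℤP.∣i*j∣≡∣i∣*∣j∣ (+ n) i ⟨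
    ∣ + n * i ∣  <⟨ ∣n*i∣<n ⟩
    n            ≡⟨ ℕP.*-identityʳ n ⟨
    n ℕ.* 1      ∎

archimedean : ∀ m .{{_ : ℕ.NonZero m}} z b → ∃[ k ] z - + m * + k < b
archimedean m z b = k , (begin-strict
  z - + m * + k  ≤⟨ ℤP.+-monoʳ-≤ z (ℤP.neg-mono-≤ k≤m*k) ⟩
  z - + k        <⟨ i+j<k⇒i-k<-j z (- b) (+ k) z-b<k ⟩
  - - b          ≡⟨ ℤP.neg-involutive b ⟩
  b              ∎)
  where
  open ℤP.≤-Reasoning
  k : ℕ
  k = suc ∣ z - b ∣
  k≤m*k : + k ≤ + m * + k
  k≤m*k = subst (+ k ≤_) (ℤP.pos-* m k) (+≤+ (ℕP.m≤n*m k m))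
  z-b<k : z - b < + k
  z-b<k = ℤP.≤-<-trans (∣i∣≤n⇒i≤n {z - b} ℕP.≤-refl) (+<+ (ℕP.n<1+n _))

bound : List ℤ → ℕ
bound = sum ∘ map ∣_∣

∈⇒∣∣≤bound : ∀ {x xs} → x ∈ xs → ∣ x ∣ ℕ.≤ bound xs
∈⇒∣∣≤bound {xs = y ∷ ys} (here refl) = ℕP.m≤m+n ∣ y ∣ (bound ys)
∈⇒∣∣≤bound {xs = y ∷ ys} (there x∈) =
  ℕP.≤-trans (∈⇒∣∣≤bound x∈) (ℕP.m≤n+m (bound ys) ∣ y ∣)

∈⇒≤bound : ∀ {x xs} → x ∈ xs → x ≤ + bound xs
∈⇒≤bound = ∣i∣≤n⇒i≤n ∘ ∈⇒∣∣≤bound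

∈⇒-bound≤ : ∀ {x xs} → x ∈ xs → - + bound xs ≤ x
∈⇒-bound≤ = ∣i∣≤n⇒-n≤i ∘ ∈⇒∣∣≤bound

∃∈? : ∀ {a p} {A : Set a} {P : A → Set p} →
      Decidable P → (xs : List A) → Dec (∃ λ x → x ∈ xs × P x)
∃∈? P? xs = map′ find (λ (_ , x∈ , px) → lose x∈ px) (any? P? xs)

shift-closed⇒≡0 : ∀ {x c xs} → x ∈ xs → (∀ {y} → y ∈ xs → y + c ∈ xs) → c ≡ 0ℤ
shift-closed⇒≡0 {x} {c} {xs} x∈ closed = ∣n*i∣<n⇒i≡0 k c (begin-strict
  ∣ + k * c ∣                ≡⟨ cong ∣_∣ (i≡j+k⇒k≡i-j {x + + k * c} {x} refl) ⟩
  ∣ (x + + k * c) - x ∣      ≤⟨ ℤP.∣i-j∣≤∣i∣+∣j∣ (x + + k * c) x ⟩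
  ∣ x + + k * c ∣ ℕ.+ ∣ x ∣  ≤⟨ ℕP.+-mono-≤ (∈⇒∣∣≤bound (iterate k)) (∈⇒∣∣≤bound x∈) ⟩
  bound xs ℕ.+ bound xs      <⟨ ℕP.n<1+n _ ⟩
  k                          ∎)
  where
  open ℕP.≤-Reasoning
  k : ℕ
  k = suc (bound xs ℕ.+ bound xs)
  iterate : ∀ n → x + + n * c ∈ xs
  iterate zero    = subst (_∈ xs) (sym (ℤP.+-identityʳ x)) x∈
  iterate (suc n) = subst (_∈ xs) (step x (+ n) c) (closed (iterate n))
    where
    step : ∀ x i c → (x + i * c) + c ≡ x + (1ℤ + i) * c
    step = solve-∀

∣⇒multℕ : ∀ {m n} → + m ∣ˢ + n → multℕ m (+ n)
∣⇒multℕ {m} m∣n with ∣⇒∣ᵤ m∣n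
... | ℕD.divides q n≡q*m = q , trans (cong +_ (trans n≡q*m (ℕP.*-comm q m))) (ℤP.pos-* m q)

multℕ⇒∣ : ∀ {m x} → multℕ m x → + m ∣ˢ x
multℕ⇒∣ (k , refl) = Signed.∣m⇒∣m*n (+ k) Signed.∣-refl

multℕ⇒0≤ : ∀ m {x} → multℕ m x → 0ℤ ≤ x
multℕ⇒0≤ m (k , refl) = subst (0ℤ ≤_) (ℤP.pos-* m k) (+≤+ ℕ.z≤n)

∣∧<0⇒multℤ₋ : ∀ {m x} → + m ∣ˢ x → x < 0ℤ → multℤ₋ m x
∣∧<0⇒multℤ₋ {x = + _} _ (+<+ ())
∣∧<0⇒multℤ₋ {m} { -[1+ n ]} m∣x _ with ∣⇒∣ᵤ m∣x
... | ℕD.divides (suc k) 1+n≡q*m =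
  k , cong -_ (trans (cong +_ (trans 1+n≡q*m (ℕP.*-comm (suc k) m))) (ℤP.pos-* m (suc k)))

multℤ₋⇒∣ : ∀ {m x} → multℤ₋ m x → + m ∣ˢ x
multℤ₋⇒∣ (k , refl) = Signed.∣m⇒∣-m (Signed.∣m⇒∣m*n (+ suc k) Signed.∣-refl)

multℤ₋⇒<0 : ∀ m .{{_ : ℕ.NonZero m}} {x} → multℤ₋ m x → x < 0ℤ
multℤ₋⇒<0 m (k , refl) =
  subst (λ i → - i < 0ℤ) (ℤP.pos-* m (suc k))
    (ℤP.neg-mono-< (+<+ (ℕP.≤-trans (ℕ.s≤s ℕ.z≤n) (ℕP.m≤n*m (suc k) m))))

OnlyVia : SubZ → SubZ → ℤ → ℤ → Set
OnlyVia C W x t = ∀ {c w} → C c → W w → t ≡ c + w → c ≡ x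

onlyVia⇒minimal : ∀ {C W} → (∀ {x} → C x → ∃ (OnlyVia C W x)) →
  ∀ (C' : SubZ) → C' ⊆ C → (Σ ℤ λ x → C x × ¬ C' x) → ¬ Covers C' W
onlyVia⇒minimal onlyVia C' C'⊆C (x , x∈C , x∉C') covers with onlyVia x∈C
... | t , t-onlyVia-x with covers t
...   | c , w , c∈C' , w∈W , t≡c+w =
  x∉C' (subst C' (t-onlyVia-x (C'⊆C c c∈C') w∈W t≡c+w) c∈C')

module Construction
  (m : ℕ) .{{_ : ℕ.NonZero m}} (B F : List ℤ) (f₀ : ℤ) (f₀∈F : f₀ ∈ F)
  (B-multiples : ∀ {b} → b ∈ B → + m ∣ˢ b)
  (F-congruent : ∀ {f} → f ∈ F → + m ∣ˢ f - f₀)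
  (f₀-nonmultiple : ¬ + m ∣ˢ f₀)
  (W : SubZ) (A≐F⊕W : (multℤ₋ m ∖ ⟦ B ⟧) ≐ (⟦ F ⟧ ⊕ W))
  where

  A C₀ C : SubZ
  A = multℤ₋ m ∖ ⟦ B ⟧
  C₀ = multℕ m ∪ ⟦ B ⟧
  C = C₀ ∪ ⟦ F ⟧

  R β L T : ℕ
  R = bound F
  β = bound B
  L = R ℕ.+ β
  T = m ℕ.* suc (R ℕ.+ R ℕ.+ R ℕ.+ L)

  N : ℤ → ℤ
  N g = + T * (g + + R + 1ℤ)

  Collision : SubZ
  Collision w = ∃ λ g → g ∈ F × ∃ λ g' → g' ∈ F × g ≢ g' × w ≡ - N g - g'

  W₁ W₂ : SubZ
  W₁ w = (W w ⊎ (+ m ∣ˢ w + f₀ × w < - + L)) × ¬ Collision w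
  W₂ w = w ≡ 0ℤ ⊎ W₁ w ⊎ (¬ + m ∣ˢ w × ¬ + m ∣ˢ w + f₀)

  collision? : Decidable Collision
  collision? w = ∃∈? (λ g → ∃∈? (λ g' → ¬? (g ℤP.≟ g') ×-dec (w ℤP.≟ - N g - g')) F) F

  C₀⇒∣ : ∀ {x} → C₀ x → + m ∣ˢ x
  C₀⇒∣ (inj₁ x∈mℕ) = multℕ⇒∣ x∈mℕ
  C₀⇒∣ (inj₂ x∈B) = B-multiples x∈B

  ∣∧∣+f₀⇒⊥ : ∀ {x} → + m ∣ˢ x → ¬ + m ∣ˢ x + f₀
  ∣∧∣+f₀⇒⊥ m∣x m∣x+f₀ = f₀-nonmultiple (Signed.∣m+n∣m⇒∣n m∣x+f₀ m∣x)

  ∣[F+w]⇒∣w+f₀ : ∀ {f w} → f ∈ F → + m ∣ˢ f + w → + m ∣ˢ w + f₀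
  ∣[F+w]⇒∣w+f₀ {f} {w} f∈F m∣f+w =
    Signed.∣m+n∣m⇒∣n (subst (+ m ∣ˢ_) (regroup f w f₀) m∣f+w) (F-congruent f∈F)
    where
    regroup : ∀ f w f₀ → f + w ≡ (f - f₀) + (w + f₀)
    regroup = solve-∀

  ∣w+f₀⇒∣[F+w] : ∀ {f w} → f ∈ F → + m ∣ˢ w + f₀ → + m ∣ˢ f + w
  ∣w+f₀⇒∣[F+w] {f} {w} f∈F m∣w+f₀ =
    subst (+ m ∣ˢ_) (regroup f w f₀) (Signed.∣m∣n⇒∣m+n (F-congruent f∈F) m∣w+f₀)
    where
    regroup : ∀ f w f₀ → (f - f₀) + (w + f₀) ≡ f + w
    regroup = solve-∀

  W₁⇒∣+f₀ : ∀ {w} → W₁ w → + m ∣ˢ w + f₀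
  W₁⇒∣+f₀ {w} (inj₁ w∈W , _) = subst (+ m ∣ˢ_) (ℤP.+-comm f₀ w) (multℤ₋⇒∣ (proj₁ f₀+w∈A))
    where
    f₀+w∈A : A (f₀ + w)
    f₀+w∈A = proj₂ A≐F⊕W (f₀ + w) (f₀ , w , f₀∈F , w∈W , refl)
  W₁⇒∣+f₀ (inj₂ (m∣w+f₀ , _) , _) = m∣w+f₀

  T-large : R ℕ.+ R ℕ.+ R ℕ.+ L ℕ.< T
  T-large = ℕP.m≤n*m _ m

  m∣T : + m ∣ˢ + T
  m∣T = subst (+ m ∣ˢ_) (sym (ℤP.pos-* m _)) (Signed.∣m⇒∣m*n _ Signed.∣-refl)

  T≤N : ∀ {g} → - + R ≤ g → + T ≤ N g
  T≤N {g} -R≤g = begin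
    + T                   ≡⟨ ℤP.*-identityʳ (+ T) ⟨
    + T * 1ℤ              ≤⟨ ℤP.*-monoˡ-≤-nonNeg (+ T) 1≤g+R+1 ⟩
    + T * (g + + R + 1ℤ)  ∎
    where
    open ℤP.≤-Reasoning
    1≤g+R+1 : 1ℤ ≤ g + + R + 1ℤ
    1≤g+R+1 = begin
      1ℤ                  ≡⟨ cong (_+ 1ℤ) (ℤP.+-inverseˡ (+ R)) ⟨
      - + R + + R + 1ℤ    ≤⟨ ℤP.+-monoˡ-≤ 1ℤ (ℤP.+-monoˡ-≤ (+ R) -R≤g) ⟩
      g + + R + 1ℤ        ∎

  -N<-L : ∀ {g} → - + R ≤ g → - N g < - + L
  -N<-L -R≤g = ℤP.≤-<-trans (ℤP.neg-mono-≤ (T≤N -R≤g))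
    (ℤP.neg-mono-< (+<+ (ℕP.≤-<-trans (ℕP.m≤n+m L (R ℕ.+ R ℕ.+ R)) T-large)))

  C-bounded-below : ∀ {c} → C c → - + L ≤ c
  C-bounded-below (inj₁ (inj₁ c∈mℕ)) = ℤP.≤-trans ℤP.neg-≤-pos (multℕ⇒0≤ m c∈mℕ)
  C-bounded-below (inj₁ (inj₂ c∈B)) =
    ℤP.≤-trans (ℤP.neg-mono-≤ (+≤+ (ℕP.m≤n+m β R))) (∈⇒-bound≤ c∈B)
  C-bounded-below (inj₂ c∈F) =
    ℤP.≤-trans (ℤP.neg-mono-≤ (+≤+ (ℕP.m≤m+n R β))) (∈⇒-bound≤ c∈F)

  F+low<-β : ∀ {f w} → f ∈ F → w < - + L → f + w < - + β
  F+low<-β {f} {w} f∈F w<-L = begin-strict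
    f + w                 <⟨ ℤP.+-mono-≤-< (∈⇒≤bound f∈F) w<-L ⟩
    + R - + L             ≡⟨ cong (λ l → + R - l) (ℤP.pos-+ R β) ⟩
    + R - (+ R + + β)     ≡⟨ cancel (+ R) (+ β) ⟩
    - + β                 ∎
    where
    open ℤP.≤-Reasoning
    cancel : ∀ r b → r - (r + b) ≡ - b
    cancel = solve-∀

  ∣-∣≤2R : ∀ {a b} → a ∈ F → b ∈ F → ∣ a - b ∣ ℕ.≤ R ℕ.+ R
  ∣-∣≤2R {a} {b} a∈F b∈F =
    ℕP.≤-trans (ℤP.∣i-j∣≤∣i∣+∣j∣ a b) (ℕP.+-mono-≤ (∈⇒∣∣≤bound a∈F) (∈⇒∣∣≤bound b∈F))

  collision-shift<-L : ∀ {y f f' g g'} → f ∈ F → f' ∈ F → g ∈ F → g' ∈ F →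
    y - f ≡ - N g - g' → y - f' < - + L
  collision-shift<-L {y} {f} {f'} {g} {g'} f∈F f'∈F g∈F g'∈F y-f≡ = begin-strict
    y - f'                        ≡⟨ regroup y f f' ⟩
    (y - f) + (f - f')            ≡⟨ cong (_+ (f - f')) y-f≡ ⟩
    (- N g - g') + (f - f')       ≡⟨ swap (N g) g' f f' ⟩
    ((f - f') - g') - N g         ≤⟨ ℤP.+-mono-≤ d≤3R (ℤP.neg-mono-≤ (T≤N (∈⇒-bound≤ g∈F))) ⟩
    + (R ℕ.+ R ℕ.+ R) - + T       <⟨ i+j<k⇒i-k<-j (+ (R ℕ.+ R ℕ.+ R)) (+ L) (+ T) 3R+L<T ⟩
    - + L                         ∎
    where
    open ℤP.≤-Reasoning
    regroup : ∀ y f f' → y - f' ≡ (y - f) + (f - f')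
    regroup = solve-∀
    swap : ∀ n g' f f' → (- n - g') + (f - f') ≡ ((f - f') - g') - n
    swap = solve-∀
    3R+L<T : + (R ℕ.+ R ℕ.+ R) + + L < + T
    3R+L<T = subst (_< + T) (ℤP.pos-+ (R ℕ.+ R ℕ.+ R) L) (+<+ T-large)
    d≤3R : (f - f') - g' ≤ + (R ℕ.+ R ℕ.+ R)
    d≤3R = ∣i∣≤n⇒i≤n {(f - f') - g'}
      (ℕP.≤-trans (ℤP.∣i-j∣≤∣i∣+∣j∣ (f - f') g') (ℕP.+-mono-≤ (∣-∣≤2R f∈F f'∈F) (∈⇒∣∣≤bound g'∈F)))

  floor : ℤ
  floor = - N (+ R) - + R

  floor<-L : floor < - + L
  floor<-L = ℤP.≤-<-trans (ℤP.i-j≤i (- N (+ R)) (+ R)) (-N<-L ℤP.neg-≤-pos)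

  floor≤Collision : ∀ {w} → Collision w → floor ≤ w
  floor≤Collision (g , g∈F , g' , g'∈F , _ , refl) =
    ℤP.+-mono-≤ (ℤP.neg-mono-≤ Ng≤NR) (ℤP.neg-mono-≤ (∈⇒≤bound g'∈F))
    where
    Ng≤NR : N g ≤ N (+ R)
    Ng≤NR = ℤP.*-monoˡ-≤-nonNeg (+ T) (ℤP.+-monoˡ-≤ 1ℤ (ℤP.+-monoˡ-≤ (+ R) (∈⇒≤bound g∈F)))

  collision-difference : ∀ {y f f' g g' h h'} → y - f ≡ - N g - g' → y - f' ≡ - N h - h' →
    + T * (g - h) ≡ (f - f') + (h' - g')
  collision-difference {y} {f} {f'} {g} {g'} {h} {h'} = difference (+ T) (+ R) y f f' g h g' h'
    where
    difference : ∀ t r y f f' g h g' h' → y - f ≡ - (t * (g + r + 1ℤ)) - g' →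
      y - f' ≡ - (t * (h + r + 1ℤ)) - h' → t * (g - h) ≡ (f - f') + (h' - g')
    difference t r y f f' g h g' h' e e' = begin
      t * (g - h)
        ≡⟨ solve (t ∷ r ∷ g ∷ h ∷ g' ∷ h' ∷ []) ⟩
      ((- (t * (h + r + 1ℤ)) - h') - (- (t * (g + r + 1ℤ)) - g')) + (h' - g')
        ≡⟨ cong₂ (λ a b → (a - b) + (h' - g')) e' e ⟨
      ((y - f') - (y - f)) + (h' - g')
        ≡⟨ solve (y ∷ f ∷ f' ∷ g' ∷ h' ∷ []) ⟩
      (f - f') + (h' - g')
        ∎
      where open ≡-Reasoning

  collisions-agree : ∀ {y f f' g g' h h'} → f ∈ F → f' ∈ F → g' ∈ F → h' ∈ F →
    y - f ≡ - N g - g' → y - f' ≡ - N h - h' → g ≡ h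
  collisions-agree {y} {f} {f'} {g} {g'} {h} {h'} f∈F f'∈F g'∈F h'∈F y-f≡ y-f'≡ =
    ℤP.i-j≡0⇒i≡j g h (∣n*i∣<n⇒i≡0 T (g - h) (begin-strict
      ∣ + T * (g - h) ∣                 ≡⟨ cong ∣_∣ T[g-h]≡ ⟩
      ∣ (f - f') + (h' - g') ∣          ≤⟨ ℤP.∣i+j∣≤∣i∣+∣j∣ (f - f') (h' - g') ⟩
      ∣ f - f' ∣ ℕ.+ ∣ h' - g' ∣        ≤⟨ ℕP.+-mono-≤ (∣-∣≤2R f∈F f'∈F) (∣-∣≤2R h'∈F g'∈F) ⟩
      R ℕ.+ R ℕ.+ (R ℕ.+ R)             ≡⟨ ℕP.+-assoc (R ℕ.+ R) R R ⟨
      R ℕ.+ R ℕ.+ R ℕ.+ R               ≤⟨ ℕP.+-monoʳ-≤ (R ℕ.+ R ℕ.+ R) (ℕP.m≤m+n R β) ⟩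
      R ℕ.+ R ℕ.+ R ℕ.+ L               <⟨ T-large ⟩
      T                                 ∎))
    where
    open ℕP.≤-Reasoning
    T[g-h]≡ : + T * (g - h) ≡ (f - f') + (h' - g')
    T[g-h]≡ = collision-difference {y} {f} {f'} {g} {g'} {h} {h'} y-f≡ y-f'≡

  low-multiple⇒A : ∀ {x} → + m ∣ˢ x → x < - + β → A x
  low-multiple⇒A m∣x x<-β =
    ∣∧<0⇒multℤ₋ m∣x (ℤP.<-≤-trans x<-β ℤP.neg-≤-pos) ,
    λ x∈B → ℤP.<⇒≱ x<-β (∈⇒-bound≤ x∈B)

  F⊕W₁⊆A : (⟦ F ⟧ ⊕ W₁) ⊆ A
  F⊕W₁⊆A _ (f , w , f∈F , (inj₁ w∈W , _) , refl) =
    proj₂ A≐F⊕W (f + w) (f , w , f∈F , w∈W , refl)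
  F⊕W₁⊆A _ (f , w , f∈F , (inj₂ (m∣w+f₀ , w<-L) , _) , refl) =
    low-multiple⇒A (∣w+f₀⇒∣[F+w] f∈F m∣w+f₀) (F+low<-β f∈F w<-L)

  no-collision-everywhere : ∀ {y f g g'} → f ∈ F → g ∈ F → g' ∈ F → y - f ≡ - N g - g' →
    ¬ (∀ {f'} → f' ∈ F → Collision (y - f'))
  no-collision-everywhere {y} {f} {g} {g'} f∈F g∈F g'∈F y-f≡ collision =
    let h' , _ , g≢h' , h'≡g+c = partner g∈F
    in g≢h' (sym (trans h'≡g+c (trans (cong (λ x → g + x) c≡0) (ℤP.+-identityʳ g))))
    where
    c : ℤ
    c = g' - f
    shifted : ∀ n y f f' g' h' → y - f ≡ n - g' → y - f' ≡ n - h' → h' ≡ f' + (g' - f)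
    shifted n y f f' g' h' e e' = begin
      h'
        ≡⟨ solve (n ∷ y ∷ f ∷ f' ∷ g' ∷ h' ∷ []) ⟩
      f' + (g' - f) + ((n - g') - (y - f)) - ((n - h') - (y - f'))
        ≡⟨ cong₂ (λ a b → f' + (g' - f) + (a - (y - f)) - (b - (y - f'))) e e' ⟨
      f' + (g' - f) + ((y - f) - (y - f)) - ((y - f') - (y - f'))
        ≡⟨ solve (y ∷ f ∷ f' ∷ g' ∷ []) ⟩
      f' + (g' - f)
        ∎
      where open ≡-Reasoning
    partner : ∀ {f'} → f' ∈ F → ∃ λ h' → h' ∈ F × g ≢ h' × h' ≡ f' + c
    partner {f'} f'∈F =
      let h , _ , h' , h'∈F , h≢h' , y-f'≡ = collision f'∈F
          g≡h = collisions-agree {y} {f} {f'} {g} {g'} {h} {h'} f∈F f'∈F g'∈F h'∈F y-f≡ y-f'≡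
          y-f'≡ₕ = subst (λ u → y - f' ≡ - N u - h') (sym g≡h) y-f'≡
      in h' , h'∈F , subst (_≢ h') (sym g≡h) h≢h' , shifted (- N g) y f f' g' h' y-f≡ y-f'≡ₕ
    c≡0 : c ≡ 0ℤ
    c≡0 = shift-closed⇒≡0 g∈F λ f'∈F →
      let _ , h'∈F , _ , h'≡f'+c = partner f'∈F in subst (_∈ F) h'≡f'+c h'∈F

  collision-avoidable : ∀ {y f g g'} → A y → f ∈ F → g ∈ F → g' ∈ F →
    y - f ≡ - N g - g' → (⟦ F ⟧ ⊕ W₁) y
  collision-avoidable {y} y∈A f∈F g∈F g'∈F y-f≡ with ∃∈? (λ f' → ¬? (collision? (y - f'))) F
  ... | yes (f' , f'∈F , ¬collision) =
    f' , y - f' , f'∈F , (inj₂ (m∣y-f'+f₀ , y-f'<-L) , ¬collision) , i≡j+[i-j] y f'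
    where
    regroup : ∀ y f f₀ → y - (f - f₀) ≡ (y - f) + f₀
    regroup = solve-∀
    m∣y-f'+f₀ : + m ∣ˢ (y - f') + f₀
    m∣y-f'+f₀ = subst (+ m ∣ˢ_) (regroup y f' f₀)
                  (Signed.∣m∣n⇒∣m-n (multℤ₋⇒∣ (proj₁ y∈A)) (F-congruent f'∈F))
    y-f'<-L : y - f' < - + L
    y-f'<-L = collision-shift<-L {y} f∈F f'∈F g∈F g'∈F y-f≡
  ... | no ∄f' = ⊥-elim (no-collision-everywhere {y} f∈F g∈F g'∈F y-f≡ λ {f'} f'∈F →
    decidable-stable (collision? (y - f')) (λ ¬collision → ∄f' (f' , f'∈F , ¬collision)))

  A⊆F⊕W₁ : A ⊆ (⟦ F ⟧ ⊕ W₁)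
  A⊆F⊕W₁ y y∈A with proj₁ A≐F⊕W y y∈A
  ... | f , w , f∈F , w∈W , y≡f+w with collision? w
  ...   | no ¬collision = f , w , f∈F , (inj₁ w∈W , ¬collision) , y≡f+w
  ...   | yes (g , g∈F , g' , g'∈F , _ , w≡) =
    collision-avoidable y∈A f∈F g∈F g'∈F (trans (sym (i≡j+k⇒k≡i-j y≡f+w)) w≡)

  A∩C₀≡∅ : ∀ {x} → A x → ¬ C₀ x
  A∩C₀≡∅ {x} (x∈mℤ₋ , _) (inj₁ x∈mℕ) =
    ℤP.<⇒≱ (multℤ₋⇒<0 m {x} x∈mℤ₋) (multℕ⇒0≤ m {x} x∈mℕ)
  A∩C₀≡∅ (_ , x∉B) (inj₂ x∈B) = x∉B x∈B

  far-representation : ∀ {z} → + m ∣ˢ z + f₀ → (C ⊕ W₂) z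
  far-representation {z} m∣z+f₀ =
    + m * + k , w , inj₁ (inj₁ (k , refl)) , inj₂ (inj₁ w∈W₁) , i≡j+[i-j] z (+ m * + k)
    where
    k : ℕ
    k = proj₁ (archimedean m z floor)
    w : ℤ
    w = z - + m * + k
    w<floor : w < floor
    w<floor = proj₂ (archimedean m z floor)
    regroup : ∀ z a f₀ → (z + f₀) - a ≡ (z - a) + f₀
    regroup = solve-∀
    m∣w+f₀ : + m ∣ˢ w + f₀
    m∣w+f₀ = subst (+ m ∣ˢ_) (regroup z (+ m * + k) f₀)
               (Signed.∣m∣n⇒∣m-n m∣z+f₀ (multℕ⇒∣ (k , refl)))
    w∈W₁ : W₁ w
    w∈W₁ = inj₂ (m∣w+f₀ , ℤP.<-trans w<floor floor<-L) ,
           λ collision → ℤP.<⇒≱ w<floor (floor≤Collision collision)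

  covers : Covers C W₂
  covers z with + m ∣ˢ? z
  covers (+ n) | yes m∣z =
    + n , 0ℤ , inj₁ (inj₁ (∣⇒multℕ m∣z)) , inj₁ refl , sym (ℤP.+-identityʳ (+ n))
  covers z@(-[1+ _ ]) | yes m∣z with z ∈? B
  ... | yes z∈B = z , 0ℤ , inj₁ (inj₂ z∈B) , inj₁ refl , sym (ℤP.+-identityʳ z)
  ... | no z∉B =
    let f , w , f∈F , w∈W₁ , z≡f+w = A⊆F⊕W₁ z (∣∧<0⇒multℤ₋ m∣z ℤ.-<+ , z∉B)
    in f , w , inj₂ f∈F , inj₂ (inj₁ w∈W₁) , z≡f+w
  covers z | no m∤z with + m ∣ˢ? z + f₀
  ... | yes m∣z+f₀ = far-representation m∣z+f₀
  ... | no m∤z+f₀ = 0ℤ , z , inj₁ (inj₁ 0∈mℕ) , inj₂ (inj₂ (m∤z , m∤z+f₀)) , sym (ℤP.+-identityˡ z)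
    where
    0∈mℕ : multℕ m 0ℤ
    0∈mℕ = 0 , sym (ℤP.*-zeroʳ (+ m))

  multiple-representation : ∀ {c w} → C c → W₂ w → + m ∣ˢ c + w → w ≡ 0ℤ ⊎ (c ∈ F × W₁ w)
  multiple-representation _ (inj₁ w≡0) _ = inj₁ w≡0
  multiple-representation (inj₁ c∈C₀) (inj₂ (inj₁ w∈W₁)) m∣c+w =
    ⊥-elim (∣∧∣+f₀⇒⊥ (Signed.∣m+n∣m⇒∣n m∣c+w (C₀⇒∣ c∈C₀)) (W₁⇒∣+f₀ w∈W₁))
  multiple-representation (inj₁ c∈C₀) (inj₂ (inj₂ (m∤w , _))) m∣c+w =
    ⊥-elim (m∤w (Signed.∣m+n∣m⇒∣n m∣c+w (C₀⇒∣ c∈C₀)))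
  multiple-representation (inj₂ c∈F) (inj₂ (inj₁ w∈W₁)) _ = inj₂ (c∈F , w∈W₁)
  multiple-representation (inj₂ c∈F) (inj₂ (inj₂ (_ , m∤w+f₀))) m∣c+w =
    ⊥-elim (m∤w+f₀ (∣[F+w]⇒∣w+f₀ c∈F m∣c+w))

  C₀-onlyVia-itself : ∀ {x} → C₀ x → OnlyVia C W₂ x x
  C₀-onlyVia-itself x∈C₀ {c} {w} c∈C w∈W₂ x≡c+w
    with multiple-representation c∈C w∈W₂ (subst (+ m ∣ˢ_) x≡c+w (C₀⇒∣ x∈C₀))
  ... | inj₁ w≡0 = i≡j+k⇒k≡0⇒j≡i x≡c+w w≡0
  ... | inj₂ (c∈F , w∈W₁) = ⊥-elim (A∩C₀≡∅ (F⊕W₁⊆A _ (c , w , c∈F , w∈W₁ , x≡c+w)) x∈C₀)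

  F-onlyVia-anchor : ∀ {x} → x ∈ F → OnlyVia C W₂ x (- N x)
  F-onlyVia-anchor {x} x∈F {c} {w} c∈C w∈W₂ -Nx≡c+w
    with multiple-representation c∈C w∈W₂ (subst (+ m ∣ˢ_) -Nx≡c+w m∣-Nx)
    where
    m∣-Nx : + m ∣ˢ - N x
    m∣-Nx = Signed.∣m⇒∣-m (Signed.∣m⇒∣m*n _ m∣T)
  ... | inj₁ w≡0 = ⊥-elim (ℤP.<⇒≱ (-N<-L (∈⇒-bound≤ x∈F))
                      (subst (- + L ≤_) (i≡j+k⇒k≡0⇒j≡i -Nx≡c+w w≡0) (C-bounded-below c∈C)))
  ... | inj₂ (c∈F , w∈W₁) with c ℤP.≟ x
  ...   | yes c≡x = c≡x
  ...   | no c≢x = ⊥-elim (proj₂ w∈W₁ (x , x∈F , c , c∈F , c≢x ∘ sym , i≡j+k⇒k≡i-j -Nx≡c+w))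

  private-target : ∀ {x} → C x → ∃ (OnlyVia C W₂ x)
  private-target {x} (inj₁ x∈C₀) = x , C₀-onlyVia-itself x∈C₀
  private-target {x} (inj₂ x∈F) = - N x , F-onlyVia-anchor x∈F

  isMAC : IsMAC C W₂
  isMAC = covers , onlyVia⇒minimal private-target

proposition3 : (m : ℕ) → 0 ℕ.< m → (B F : List ℤ) →
    (∀ b → b ∈ B → + m ∣ b) →
    F ≢ [] →
    (∀ f f' → f ∈ F → f' ∈ F → + m ∣ (f - f')) →
    (∀ f → f ∈ F → ¬ (+ m ∣ f)) →
    (Σ SubZ λ W → (multℤ₋ m ∖ ⟦ B ⟧) ≐ (⟦ F ⟧ ⊕ W)) →
    ArisesAsMAC ((multℕ m ∪ ⟦ B ⟧) ∪ ⟦ F ⟧)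
proposition3 _ _ _ [] _ F≢[] _ _ _ = ⊥-elim (F≢[] refl)
proposition3 m 0<m B F@(f₀ ∷ _) B-multiples _ F-congruent F-nonmultiple (W , A≐F⊕W) =
  W₂ , isMAC
  where
  open Construction m {{ℕ.>-nonZero 0<m}} B F f₀ (here refl)
    (λ {b} b∈B → ∣ᵤ⇒∣ (B-multiples b b∈B))
    (λ {f} f∈F → ∣ᵤ⇒∣ (F-congruent f f₀ f∈F (here refl)))
    (F-nonmultiple f₀ (here refl) ∘ ∣⇒∣ᵤ)
    W A≐F⊕W
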